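{- Let $r,s$ be coprime positive integers and let $\widetilde A_{r/s}=\{1\}\cup\{p+\lceil ps/r\rceil : 1\le p\le r\}$. For $a\in \widetilde A_{r/s}$ define $B(1)=UD$ and $B(p+\lceil ps/r\rceil)=U(UD)^p(DU)^{\lceil ps/r\rceil-1}D$ for $1\le p\le r$. Then for every $n\ge0$, the map sending a composition $(a_1,\dots,a_m)$ of $n$ with all parts in $\widetilde A_{r/s}$ to the path $B(a_1)\cdots B(a_m)\,UD$ is a bijection from the set of compositions of $n$ with parts in $\widetilde A_{r/s}$ onto $\widetilde R_{n+1}^{r/s}$.
   Context: Let $\mathcal D$ be the set of Dyck paths of height at most $2$: words over $\{U,D\}$ ($U=(1,1)$, $D=(1,-1)$) from $(0,0)$ to $(2n,0)$ never going below the $x$-axis and whose $U$ steps reach ordinate at most $2$; $n$ is the semilength, and the empty path $\varepsilon$ has semilength $0$. Every nonempty $P\in\mathcal D$ has the form $UwD$ where $w$ is a word in the factors $UD$ and $DU$; grouping $w$ into maximal runs gives the factorization $P=U(UD)^{p_1}(DU)^{v_1}(UD)^{p_2}(DU)^{v_2}\cdots(UD)^{p_k}(DU)^{v_k}D$, where $p_1\ge0$ and $v_k\ge0$ may be zero and all other exponents are positive; for $P=UD$ one has $k=0$. For coprime positive integers $r,s$, $\widetilde R_n^{r/s}$ is the set of paths $P\in\mathcal D$ of semilength $n$ such that, for every $i=1,\dots,k$, $p_i\le r$ and $v_i\ge\lceil p_i s/r\rceil$. A composition of $n$ is a finite sequence of positive integers summing to $n$ (the empty sequence for $n=0$). -}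

module Defs where

open import Data.Nat using (ℕ; zero; suc; _+_; _*_; _∸_; _≤_; _<_; _≟_)
open import Data.Nat.DivMod using (_/_)
open import Data.Nat.ListAction using (sum)
open import Data.List using (List; []; _∷_; _++_; concat; map; length; replicate; concatMap)
open import Data.List.Relation.Unary.All using (All)
open import Data.Product using (Σ; _×_; _,_)
open import Data.Sum using (_⊎_)
open import Data.Unit using (⊤)
open import Data.Empty using (⊥)
open import Relation.Binary.PropositionalEquality using (_≡_)
open import Relation.Nullary using (yes; no)

data Step : Set where
  U D : Step

Path : Set
Path = List Step

-- ceiling division ⌈ m / r ⌉ (only used with r ≥ 1; value 0 for r = 0)
ceilDiv : ℕ → ℕ → ℕ
ceilDiv m zero    = 0
ceilDiv m (suc k) = (m + k) / suc k

cps : (r s p : ℕ) → ℕ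
cps r s p = ceilDiv (p * s) r

DyckH2From : ℕ → Path → Set
DyckH2From h []            = h ≡ 0
DyckH2From h (U ∷ w)       = suc h ≤ 2 × DyckH2From (suc h) w
DyckH2From zero (D ∷ w)    = ⊥
DyckH2From (suc h) (D ∷ w) = DyckH2From h w

DyckH2 : Path → Set
DyckH2 = DyckH2From 0

Semilength : Path → ℕ → Set
Semilength P n = length P ≡ 2 * n

UDpow : ℕ → Path
UDpow p = concat (replicate p (U ∷ D ∷ []))

DUpow : ℕ → Path
DUpow v = concat (replicate v (D ∷ U ∷ []))

-- A factorization is the list [(p₁,v₁),…,(p_k,v_k)]; it describes the path
-- U (UD)^{p₁}(DU)^{v₁} ⋯ (UD)^{p_k}(DU)^{v_k} D   (k = 0 gives UD).
Factorization : Set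
Factorization = List (ℕ × ℕ)

buildF : Factorization → Path
buildF fs = U ∷ (concatMap (λ { (p , v) → UDpow p ++ DUpow v }) fs ++ D ∷ [])

-- Exponent positivity: p₁ ≥ 0 and v_k ≥ 0 are free, all other exponents are positive
-- (so that the runs are maximal).
FactShape : Factorization → Set
FactShape []                            = ⊤
FactShape (_ ∷ [])                      = ⊤
FactShape ((p , v) ∷ (p' , v') ∷ rest) = 1 ≤ v × 1 ≤ p' × FactShape ((p' , v') ∷ rest)

RCond : (r s : ℕ) → ℕ × ℕ → Set
RCond r s (p , v) = p ≤ r × cps r s p ≤ v

InR : (r s n : ℕ) → Path → Set
InR r s n P =
  DyckH2 P × Semilength P n ×
  Σ Factorization (λ fs → FactShape fs × buildF fs ≡ P × All (RCond r s) fs)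

InA : (r s a : ℕ) → Set
InA r s a = a ≡ 1 ⊎ Σ ℕ (λ p → 1 ≤ p × p ≤ r × a ≡ p + cps r s p)

IsComposition : ℕ → List ℕ → Set
IsComposition n c = All (λ a → 1 ≤ a) c × sum c ≡ n

Bp : (r s p : ℕ) → Path
Bp r s p = U ∷ (UDpow p ++ DUpow (cps r s p ∸ 1) ++ D ∷ [])

-- B(a): search p = 1,…,r with p + ⌈ps/r⌉ = a (such p is unique, since this
-- quantity is strictly increasing in p); otherwise (in particular a = 1) B(a) = UD.
-- On Ã_{r/s} this is exactly the paper's B.
Bsearch : (r s a : ℕ) → List ℕ → Path
Bsearch r s a []       = U ∷ D ∷ []
Bsearch r s a (p ∷ ps) with a ≟ p + cps r s p
... | yes _ = Bp r s p
... | no  _ = Bsearch r s a ps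

range1 : ℕ → List ℕ
range1 zero    = []
range1 (suc r) = range1 r ++ (suc r ∷ [])

B : (r s a : ℕ) → Path
B r s a = Bsearch r s a (range1 r)

Φ : (r s : ℕ) → List ℕ → Path
Φ r s c = concatMap (B r s) c ++ (U ∷ D ∷ [])

-- Each admissible part moves past a U as a single run: B(1) U = U (DU), and
-- B(p + ⌈ps/r⌉) U = U (UD)^p (DU)^⌈ps/r⌉ with ⌈ps/r⌉ ≥ 1.  Since the image ends in UD,
-- B(a₁)⋯B(aₘ) UD = U w D with w the concatenation of the runs of the parts; merging every run
-- without (UD) into its predecessor gives the factorization, and p ≤ r, v ≥ ⌈ps/r⌉ hold by
-- construction.  Conversely a run (p, v) with p ≥ 1 is spelled by the part p + ⌈ps/r⌉ followed
-- by v − ⌈ps/r⌉ ones, and a run (0, v) by v ones.  Injectivity: the first part's p is read off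
-- the prefix U (UD)^p D of the image, and p ↦ p + ⌈ps/r⌉ is strictly increasing.
module Submission where

open import Defs
open import Data.Nat using (ℕ; zero; suc; _+_; _*_; _∸_; _≤_; z≤n; s≤s; _≟_)
open import Data.Nat.Properties
open import Data.Nat.Coprimality using (Coprime)
open import Data.Nat.DivMod using (m<n⇒m/n≡0; m≥n⇒m/n>0; /-monoˡ-≤)
open import Data.Nat.ListAction using (sum)
open import Data.List using (List; []; _∷_; _++_; length; replicate; concatMap)
open import Data.List.Properties using (++-assoc; ++-identityʳ; ++-cancelˡ; ∷-injectiveˡ; ∷-injectiveʳ; length-++; concatMap-++)
open import Data.List.Membership.Propositional using (_∈_)
open import Data.List.Membership.Propositional.Properties using (∈-++⁺ˡ; ∈-++⁺ʳ)
open import Data.List.Relation.Unary.All as All using (All; []; _∷_)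
open import Data.List.Relation.Unary.All.Properties using (++⁺)
open import Data.List.Relation.Unary.Any using (here; there)
open import Data.Product using (Σ; _×_; _,_; proj₁; proj₂)
open import Data.Sum using (inj₁; inj₂)
open import Data.Unit using (tt)
open import Data.Empty using (⊥-elim)
open import Relation.Binary.Definitions using (tri<; tri≈; tri>)
open import Relation.Binary.PropositionalEquality
  using (_≡_; _≢_; refl; sym; trans; cong; cong₂; subst; module ≡-Reasoning)
open import Relation.Nullary using (yes; no)
open import Function using (_∘_)

open ≡-Reasoning

module _ {a b p q} {A : Set a} {B : Set b} {P : A → Set p} {Q : B → Set q} where

  All-reduce : (f : ∀ {x} → P x → B) → (∀ {x} (px : P x) → Q (f px)) →
               ∀ {xs} (pxs : All P xs) → All Q (All.reduce f pxs)
  All-reduce f g []         = []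
  All-reduce f g (px ∷ pxs) = g px ∷ All-reduce f g pxs

run : ℕ × ℕ → Path
run (p , v) = UDpow p ++ DUpow v

runs : Factorization → Path
runs = concatMap run

buildF-runs : ∀ fs → buildF fs ≡ U ∷ (runs fs ++ D ∷ [])
buildF-runs fs = refl

length-UDpow : ∀ p → length (UDpow p) ≡ 2 * p
length-UDpow zero    = refl
length-UDpow (suc p) = trans (cong (2 +_) (length-UDpow p)) (sym (*-suc 2 p))

length-DUpow : ∀ v → length (DUpow v) ≡ 2 * v
length-DUpow zero    = refl
length-DUpow (suc v) = trans (cong (2 +_) (length-DUpow v)) (sym (*-suc 2 v))

length-run : ∀ p v → length (run (p , v)) ≡ 2 * (p + v)
length-run p v = begin
  length (UDpow p ++ DUpow v)           ≡⟨ length-++ (UDpow p) ⟩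
  length (UDpow p) + length (DUpow v)   ≡⟨ cong₂ _+_ (length-UDpow p) (length-DUpow v) ⟩
  2 * p + 2 * v                         ≡⟨ *-distribˡ-+ 2 p v ⟨
  2 * (p + v)                           ∎

DUpow-+ : ∀ m n → DUpow (m + n) ≡ DUpow m ++ DUpow n
DUpow-+ zero    n = refl
DUpow-+ (suc m) n = cong (λ w → D ∷ U ∷ w) (DUpow-+ m n)

DUpow-++-DUpow-∸ : ∀ {m n} → m ≤ n → ∀ Y → DUpow m ++ DUpow (n ∸ m) ++ Y ≡ DUpow n ++ Y
DUpow-++-DUpow-∸ {m} {n} m≤n Y = begin
  DUpow m ++ DUpow (n ∸ m) ++ Y     ≡⟨ ++-assoc (DUpow m) _ Y ⟨
  (DUpow m ++ DUpow (n ∸ m)) ++ Y   ≡⟨ cong (_++ Y) (DUpow-+ m (n ∸ m)) ⟨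
  DUpow (m + (n ∸ m)) ++ Y          ≡⟨ cong (λ k → DUpow k ++ Y) (m+[n∸m]≡n m≤n) ⟩
  DUpow n ++ Y                      ∎

UDpow-++-D-injective : ∀ p q {Y Z} → UDpow p ++ D ∷ Y ≡ UDpow q ++ D ∷ Z → p ≡ q
UDpow-++-D-injective zero    zero    _ = refl
UDpow-++-D-injective zero    (suc q) e with () ← ∷-injectiveˡ e
UDpow-++-D-injective (suc p) zero    e with () ← ∷-injectiveˡ e
UDpow-++-D-injective (suc p) (suc q) e =
  cong suc (UDpow-++-D-injective p q (∷-injectiveʳ (∷-injectiveʳ e)))

D∷[]≢UDpow-++-D∷U∷ : ∀ p Y → D ∷ [] ≢ UDpow p ++ D ∷ U ∷ Y
D∷[]≢UDpow-++-D∷U∷ zero    Y ()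
D∷[]≢UDpow-++-D∷U∷ (suc p) Y ()

run-++-as-D∷U : ∀ p {v} → 1 ≤ v → ∀ Y → Σ Path λ Z → run (p , v) ++ Y ≡ UDpow p ++ D ∷ U ∷ Z
run-++-as-D∷U p {suc v} _ Y = DUpow v ++ Y , ++-assoc (UDpow p) (DUpow (suc v)) Y

DyckH2From-1-run : ∀ x {Y} → DyckH2From 1 Y → DyckH2From 1 (run x ++ Y)
DyckH2From-1-run (p , v) {Y} h =
  subst (DyckH2From 1) (sym (++-assoc (UDpow p) (DUpow v) Y)) (UDpow-step p (DUpow-step v h))
  where
  UDpow-step : ∀ p {Y} → DyckH2From 1 Y → DyckH2From 1 (UDpow p ++ Y)
  UDpow-step zero    h = h
  UDpow-step (suc p) h = s≤s (s≤s z≤n) , UDpow-step p h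
  DUpow-step : ∀ v {Y} → DyckH2From 1 Y → DyckH2From 1 (DUpow v ++ Y)
  DUpow-step zero    h = h
  DUpow-step (suc v) h = s≤s z≤n , DUpow-step v h

buildF-DyckH2 : ∀ fs → DyckH2 (buildF fs)
buildF-DyckH2 fs = s≤s z≤n , runs-step fs
  where
  runs-step : ∀ fs → DyckH2From 1 (runs fs ++ D ∷ [])
  runs-step []       = refl
  runs-step (x ∷ fs) =
    subst (DyckH2From 1) (sym (++-assoc (run x) (runs fs) (D ∷ []))) (DyckH2From-1-run x (runs-step fs))

prependRun : ℕ × ℕ → Factorization → Factorization
prependRun x       []                   = x ∷ []
prependRun (p , v) ((zero , v') ∷ fs)   = (p , v + v') ∷ fs
prependRun x       ((suc p' , v') ∷ fs) = x ∷ (suc p' , v') ∷ fs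

merge : Factorization → Factorization
merge []       = []
merge (x ∷ fs) = prependRun x (merge fs)

runs-prependRun : ∀ x fs → runs (prependRun x fs) ≡ run x ++ runs fs
runs-prependRun x       []                   = refl
runs-prependRun x       ((suc p' , v') ∷ fs) = refl
runs-prependRun (p , v) ((zero , v') ∷ fs)   = begin
  (UDpow p ++ DUpow (v + v')) ++ runs fs          ≡⟨ cong (λ w → (UDpow p ++ w) ++ runs fs) (DUpow-+ v v') ⟩
  (UDpow p ++ (DUpow v ++ DUpow v')) ++ runs fs   ≡⟨ cong (_++ runs fs) (++-assoc (UDpow p) (DUpow v) (DUpow v')) ⟨
  ((UDpow p ++ DUpow v) ++ DUpow v') ++ runs fs   ≡⟨ ++-assoc (UDpow p ++ DUpow v) (DUpow v') (runs fs) ⟩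
  (UDpow p ++ DUpow v) ++ DUpow v' ++ runs fs     ∎

runs-merge : ∀ fs → runs (merge fs) ≡ runs fs
runs-merge []       = refl
runs-merge (x ∷ fs) = trans (runs-prependRun x (merge fs)) (cong (run x ++_) (runs-merge fs))

FactShape-prependRun : ∀ p {v} fs → 1 ≤ v → FactShape fs → FactShape (prependRun (p , v) fs)
FactShape-prependRun p     []                          _   _                  = tt
FactShape-prependRun p     ((zero , v') ∷ [])          _   _                  = tt
FactShape-prependRun p {v} ((zero , v') ∷ (_ , _) ∷ _) 1≤v (_ , 1≤p'' , sh) = ≤-trans 1≤v (m≤m+n v v') , 1≤p'' , sh
FactShape-prependRun p     ((suc p' , v') ∷ fs)        1≤v sh                 = 1≤v , s≤s z≤n , sh

FactShape-merge : ∀ fs → All (λ x → 1 ≤ proj₂ x) fs → FactShape (merge fs)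
FactShape-merge []             []           = tt
FactShape-merge ((p , v) ∷ fs) (1≤v ∷ 1≤vs) = FactShape-prependRun p (merge fs) 1≤v (FactShape-merge fs 1≤vs)

module _ (r s : ℕ) where

  RCond-prependRun : ∀ x fs → RCond r s x → All (RCond r s) fs → All (RCond r s) (prependRun x fs)
  RCond-prependRun x       []                   cx          cfs       = cx ∷ []
  RCond-prependRun (p , v) ((zero , v') ∷ fs)   (p≤r , c≤v) (_ ∷ cfs) = (p≤r , ≤-trans c≤v (m≤m+n v v')) ∷ cfs
  RCond-prependRun x       ((suc p' , v') ∷ fs) cx          cfs       = cx ∷ cfs

  RCond-merge : ∀ fs → All (RCond r s) fs → All (RCond r s) (merge fs)
  RCond-merge []       []         = []
  RCond-merge (x ∷ fs) (cx ∷ cfs) = RCond-prependRun x (merge fs) cx (RCond-merge fs cfs)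

ceilDiv-zero : ∀ k → ceilDiv 0 (suc k) ≡ 0
ceilDiv-zero k = m<n⇒m/n≡0 (n<1+n k)

ceilDiv-pos : ∀ k {m} → 1 ≤ m → 1 ≤ ceilDiv m (suc k)
ceilDiv-pos k 1≤m = m≥n⇒m/n>0 (+-monoˡ-≤ k 1≤m)

ceilDiv-mono : ∀ r {m n} → m ≤ n → ceilDiv m r ≤ ceilDiv n r
ceilDiv-mono zero    m≤n = z≤n
ceilDiv-mono (suc k) m≤n = /-monoˡ-≤ (suc k) (+-monoˡ-≤ k m≤n)

cps-mono : ∀ r s {p q} → p ≤ q → cps r s p ≤ cps r s q
cps-mono r s p≤q = ceilDiv-mono r (*-monoˡ-≤ s p≤q)

+cps-injective : ∀ r s {p q} → p + cps r s p ≡ q + cps r s q → p ≡ q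
+cps-injective r s {p} {q} e with <-cmp p q
... | tri≈ _ p≡q _ = p≡q
... | tri< p<q _ _ = ⊥-elim (<⇒≢ (+-mono-<-≤ p<q (cps-mono r s (<⇒≤ p<q))) e)
... | tri> _ _ q<p = ⊥-elim (<⇒≢ (+-mono-<-≤ q<p (cps-mono r s (<⇒≤ q<p))) (sym e))

∈-range1 : ∀ n {p} → 1 ≤ p → p ≤ n → p ∈ range1 n
∈-range1 zero    (s≤s _) ()
∈-range1 (suc n) 1≤p p≤1+n with m≤n⇒m<n∨m≡n p≤1+n
... | inj₁ (s≤s p≤n) = ∈-++⁺ˡ (∈-range1 n 1≤p p≤n)
... | inj₂ refl      = ∈-++⁺ʳ (range1 n) (here refl)

Bsearch-+cps : ∀ r s {p ps} → p ∈ ps → Bsearch r s (p + cps r s p) ps ≡ Bp r s p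
Bsearch-+cps r s {p} {q ∷ ps} p∈ with p + cps r s p ≟ q + cps r s q | p∈
... | yes e | _          = cong (Bp r s) (sym (+cps-injective r s e))
... | no ne | here refl  = ⊥-elim (ne refl)
... | no _  | there p∈ps = Bsearch-+cps r s p∈ps

Bsearch-default : ∀ r s {a} ps → (∀ p → a ≢ p + cps r s p) → Bsearch r s a ps ≡ U ∷ D ∷ []
Bsearch-default r s     []       _  = refl
Bsearch-default r s {a} (q ∷ ps) a≢ with a ≟ q + cps r s q
... | yes e = ⊥-elim (a≢ q e)
... | no _  = Bsearch-default r s ps a≢

Bp-++-U : ∀ r s p → 1 ≤ cps r s p → ∀ Y → Bp r s p ++ U ∷ Y ≡ U ∷ (run (p , cps r s p) ++ Y)
Bp-++-U r s p 1≤c Y = cong (U ∷_) (body (cps r s p) 1≤c)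
  where
  body : ∀ m → 1 ≤ m → (UDpow p ++ DUpow (m ∸ 1) ++ D ∷ []) ++ U ∷ Y ≡ run (p , m) ++ Y
  body (suc m) _ = begin
    (UDpow p ++ DUpow m ++ D ∷ []) ++ U ∷ Y   ≡⟨ ++-assoc (UDpow p) _ _ ⟩
    UDpow p ++ (DUpow m ++ D ∷ []) ++ U ∷ Y   ≡⟨ cong (UDpow p ++_) (++-assoc (DUpow m) _ _) ⟩
    UDpow p ++ DUpow m ++ DUpow 1 ++ Y        ≡⟨ cong (UDpow p ++_) (++-assoc (DUpow m) (DUpow 1) Y) ⟨
    UDpow p ++ (DUpow m ++ DUpow 1) ++ Y      ≡⟨ cong (λ w → UDpow p ++ w ++ Y) (DUpow-+ m 1) ⟨
    UDpow p ++ DUpow (m + 1) ++ Y             ≡⟨ cong (λ n → UDpow p ++ DUpow n ++ Y) (+-comm m 1) ⟩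
    UDpow p ++ DUpow (suc m) ++ Y             ≡⟨ ++-assoc (UDpow p) _ Y ⟨
    run (p , suc m) ++ Y                      ∎

InA⇒1≤ : ∀ r s {a} → InA r s a → 1 ≤ a
InA⇒1≤ r s (inj₁ refl)                = s≤s z≤n
InA⇒1≤ r s (inj₂ (p , 1≤p , _ , refl)) = ≤-trans 1≤p (m≤m+n p _)

module Admissible (k s : ℕ) (1≤s : 1 ≤ s) where

  private
    r : ℕ
    r = suc k

  cps-pos : ∀ {p} → 1 ≤ p → 1 ≤ cps r s p
  cps-pos 1≤p = ceilDiv-pos k (*-mono-≤ 1≤p 1≤s)

  1≢+cps : ∀ p → 1 ≢ p + cps r s p
  1≢+cps zero    e = 1≢0 (trans e (ceilDiv-zero k))
    where
    1≢0 : 1 ≢ 0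
    1≢0 ()
  1≢+cps (suc p) e = <⇒≢ (cps-pos (s≤s (z≤n {p}))) (sym (m+n≡0⇒n≡0 p (sym (suc-injective e))))

  B-1 : B r s 1 ≡ U ∷ D ∷ []
  B-1 = Bsearch-default r s (range1 r) 1≢+cps

  B-+cps : ∀ {p} → 1 ≤ p → p ≤ r → B r s (p + cps r s p) ≡ Bp r s p
  B-+cps 1≤p p≤r = Bsearch-+cps r s (∈-range1 r 1≤p p≤r)

  block : ∀ {a} → InA r s a → ℕ × ℕ
  block (inj₁ _)       = 0 , 1
  block (inj₂ (p , _)) = p , cps r s p

  B-++-U : ∀ {a} (a∈A : InA r s a) Y → B r s a ++ U ∷ Y ≡ U ∷ (run (block a∈A) ++ Y)
  B-++-U (inj₁ refl)                   Y = cong (_++ U ∷ Y) B-1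
  B-++-U (inj₂ (p , 1≤p , p≤r , refl)) Y =
    trans (cong (_++ U ∷ Y) (B-+cps 1≤p p≤r)) (Bp-++-U r s p (cps-pos 1≤p) Y)

  block-sum : ∀ {a} (a∈A : InA r s a) → a ≡ proj₁ (block a∈A) + proj₂ (block a∈A)
  block-sum (inj₁ refl)               = refl
  block-sum (inj₂ (_ , _ , _ , refl)) = refl

  block-pos : ∀ {a} (a∈A : InA r s a) → 1 ≤ proj₂ (block a∈A)
  block-pos (inj₁ _)             = s≤s z≤n
  block-pos (inj₂ (_ , 1≤p , _)) = cps-pos 1≤p

  block-RCond : ∀ {a} (a∈A : InA r s a) → RCond r s (block a∈A)
  block-RCond (inj₁ _)                 = z≤n , subst (_≤ 1) (sym (ceilDiv-zero k)) z≤n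
  block-RCond (inj₂ (_ , _ , p≤r , _)) = p≤r , ≤-refl

  block-injective : ∀ {a a'} (a∈A : InA r s a) (a'∈A : InA r s a') →
                    proj₁ (block a∈A) ≡ proj₁ (block a'∈A) → a ≡ a'
  block-injective (inj₁ refl)               (inj₁ refl)               _    = refl
  block-injective (inj₁ _)                  (inj₂ (_ , 1≤p , _))      refl with () ← 1≤p
  block-injective (inj₂ (_ , 1≤p , _))      (inj₁ _)                  refl with () ← 1≤p
  block-injective (inj₂ (_ , _ , _ , refl)) (inj₂ (_ , _ , _ , refl)) refl = refl

  length-B : ∀ {a} → InA r s a → length (B r s a) ≡ 2 * a
  length-B {a} a∈A = suc-injective (begin
    suc (length (B r s a))                ≡⟨ +-comm 1 _ ⟩
    length (B r s a) + length (U ∷ [])    ≡⟨ length-++ (B r s a) ⟨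
    length (B r s a ++ U ∷ [])            ≡⟨ cong length (B-++-U a∈A []) ⟩
    suc (length (run (p , v) ++ []))      ≡⟨ cong (suc ∘ length) (++-identityʳ (run (p , v))) ⟩
    suc (length (run (p , v)))            ≡⟨ cong suc (length-run p v) ⟩
    suc (2 * (p + v))                     ≡⟨ cong (suc ∘ (2 *_)) (block-sum a∈A) ⟨
    suc (2 * a)                           ∎)
    where
    p = proj₁ (block a∈A)
    v = proj₂ (block a∈A)

  blocks : ∀ {cs} → All (InA r s) cs → Factorization
  blocks = All.reduce block

  Φ-∷ : ∀ a cs → Φ r s (a ∷ cs) ≡ B r s a ++ Φ r s cs
  Φ-∷ a cs = ++-assoc (B r s a) (concatMap (B r s) cs) (U ∷ D ∷ [])

  Φ-runs : ∀ {cs} (cs∈A : All (InA r s) cs) → Φ r s cs ≡ U ∷ (runs (blocks cs∈A) ++ D ∷ [])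
  Φ-runs []                     = refl
  Φ-runs {a ∷ cs} (a∈A ∷ cs∈A) = begin
    Φ r s (a ∷ cs)                                      ≡⟨ Φ-∷ a cs ⟩
    B r s a ++ Φ r s cs                                 ≡⟨ cong (B r s a ++_) (Φ-runs cs∈A) ⟩
    B r s a ++ U ∷ (runs (blocks cs∈A) ++ D ∷ [])       ≡⟨ B-++-U a∈A _ ⟩
    U ∷ (run x ++ runs (blocks cs∈A) ++ D ∷ [])         ≡⟨ cong (U ∷_) (++-assoc (run x) _ _) ⟨
    U ∷ (runs (blocks (a∈A ∷ cs∈A)) ++ D ∷ [])          ∎
    where
    x = block a∈A

  Φ-buildF : ∀ {cs} (cs∈A : All (InA r s) cs) → Φ r s cs ≡ buildF (merge (blocks cs∈A))
  Φ-buildF {cs} cs∈A = begin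
    Φ r s cs                                             ≡⟨ Φ-runs cs∈A ⟩
    U ∷ (runs (blocks cs∈A) ++ D ∷ [])                   ≡⟨ cong (λ w → U ∷ (w ++ D ∷ [])) (runs-merge (blocks cs∈A)) ⟨
    U ∷ (runs (merge (blocks cs∈A)) ++ D ∷ [])           ≡⟨ buildF-runs (merge (blocks cs∈A)) ⟨
    buildF (merge (blocks cs∈A))                         ∎

  length-Φ : ∀ {cs} → All (InA r s) cs → length (Φ r s cs) ≡ 2 * suc (sum cs)
  length-Φ {cs} cs∈A = begin
    length (Φ r s cs)                                 ≡⟨ length-++ (concatMap (B r s) cs) ⟩
    length (concatMap (B r s) cs) + 2                 ≡⟨ cong (_+ 2) (length-concatMap cs∈A) ⟩
    2 * sum cs + 2                                    ≡⟨ +-comm (2 * sum cs) 2 ⟩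
    2 + 2 * sum cs                                    ≡⟨ *-suc 2 (sum cs) ⟨
    2 * suc (sum cs)                                  ∎
    where
    length-concatMap : ∀ {cs} → All (InA r s) cs → length (concatMap (B r s) cs) ≡ 2 * sum cs
    length-concatMap []                       = refl
    length-concatMap {a ∷ cs} (a∈A ∷ cs∈A) = begin
      length (B r s a ++ concatMap (B r s) cs)            ≡⟨ length-++ (B r s a) ⟩
      length (B r s a) + length (concatMap (B r s) cs)    ≡⟨ cong₂ _+_ (length-B a∈A) (length-concatMap cs∈A) ⟩
      2 * a + 2 * sum cs                                  ≡⟨ *-distribˡ-+ 2 a (sum cs) ⟨
      2 * (a + sum cs)                                    ∎

  Φ-InR : ∀ n {cs} → IsComposition n cs → All (InA r s) cs → InR r s (suc n) (Φ r s cs)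
  Φ-InR n {cs} (_ , Σcs≡n) cs∈A =
    subst DyckH2 (sym Φ≡buildF) (buildF-DyckH2 fs) ,
    trans (length-Φ cs∈A) (cong (λ m → 2 * suc m) Σcs≡n) ,
    fs ,
    FactShape-merge (blocks cs∈A) (All-reduce block block-pos cs∈A) ,
    sym Φ≡buildF ,
    RCond-merge r s (blocks cs∈A) (All-reduce block block-RCond cs∈A)
    where
    fs : Factorization
    fs = merge (blocks cs∈A)
    Φ≡buildF : Φ r s cs ≡ buildF fs
    Φ≡buildF = Φ-buildF cs∈A

  Φ-∷-prefix : ∀ {a cs} (a∈A : InA r s a) → All (InA r s) cs →
               Σ Path λ Z → Φ r s (a ∷ cs) ≡ U ∷ (UDpow (proj₁ (block a∈A)) ++ D ∷ U ∷ Z)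
  Φ-∷-prefix {a} {cs} a∈A cs∈A =
    let Z , run≡ = run-++-as-D∷U (proj₁ (block a∈A)) (block-pos a∈A) (runs (blocks cs∈A) ++ D ∷ [])
    in  Z , trans (Φ-∷ a cs) (trans (cong (B r s a ++_) (Φ-runs cs∈A))
                               (trans (B-++-U a∈A _) (cong (U ∷_) run≡)))

  Φ-injective : ∀ {cs cs'} → All (InA r s) cs → All (InA r s) cs' → Φ r s cs ≡ Φ r s cs' → cs ≡ cs'
  Φ-injective []           []             _ = refl
  Φ-injective []           (a'∈A ∷ cs'∈A) e =
    let Z , e' = Φ-∷-prefix a'∈A cs'∈A
    in  ⊥-elim (D∷[]≢UDpow-++-D∷U∷ (proj₁ (block a'∈A)) Z (∷-injectiveʳ (trans e e')))
  Φ-injective (a∈A ∷ cs∈A) []             e =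
    let Z , e' = Φ-∷-prefix a∈A cs∈A
    in  ⊥-elim (D∷[]≢UDpow-++-D∷U∷ (proj₁ (block a∈A)) Z (∷-injectiveʳ (trans (sym e) e')))
  Φ-injective {a ∷ cs} {a' ∷ cs'} (a∈A ∷ cs∈A) (a'∈A ∷ cs'∈A) e =
    cong₂ _∷_ a≡a' (Φ-injective cs∈A cs'∈A tails≡)
    where
    e-B : B r s a ++ Φ r s cs ≡ B r s a' ++ Φ r s cs'
    e-B = trans (sym (Φ-∷ a cs)) (trans e (Φ-∷ a' cs'))
    a≡a' : a ≡ a'
    a≡a' =
      let Z , eZ = Φ-∷-prefix a∈A cs∈A
          Z' , eZ' = Φ-∷-prefix a'∈A cs'∈A
      in  block-injective a∈A a'∈A
            (UDpow-++-D-injective _ _ (∷-injectiveʳ (trans (sym eZ) (trans e eZ'))))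
    tails≡ : Φ r s cs ≡ Φ r s cs'
    tails≡ = ++-cancelˡ (B r s a) _ _ (trans e-B (cong (λ x → B r s x ++ Φ r s cs') (sym a≡a')))

  partsOfRun : ℕ × ℕ → List ℕ
  partsOfRun (zero  , v) = replicate v 1
  partsOfRun (suc p , v) = (suc p + cps r s (suc p)) ∷ replicate (v ∸ cps r s (suc p)) 1

  partsOf : Factorization → List ℕ
  partsOf = concatMap partsOfRun

  ones-InA : ∀ v → All (InA r s) (replicate v 1)
  ones-InA zero    = []
  ones-InA (suc v) = inj₁ refl ∷ ones-InA v

  partsOf-InA : ∀ {fs} → All (RCond r s) fs → All (InA r s) (partsOf fs)
  partsOf-InA []                         = []
  partsOf-InA {(zero  , v) ∷ _} (_ ∷ cfs)         = ++⁺ (ones-InA v) (partsOf-InA cfs)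
  partsOf-InA {(suc p , v) ∷ _} ((p≤r , _) ∷ cfs) =
    ++⁺ (inj₂ (suc p , s≤s z≤n , p≤r , refl) ∷ ones-InA _) (partsOf-InA cfs)

  ones-++-U : ∀ v Y → concatMap (B r s) (replicate v 1) ++ U ∷ Y ≡ U ∷ (DUpow v ++ Y)
  ones-++-U zero    Y = refl
  ones-++-U (suc v) Y = begin
    (B r s 1 ++ concatMap (B r s) (replicate v 1)) ++ U ∷ Y   ≡⟨ ++-assoc (B r s 1) _ _ ⟩
    B r s 1 ++ concatMap (B r s) (replicate v 1) ++ U ∷ Y     ≡⟨ cong (B r s 1 ++_) (ones-++-U v Y) ⟩
    B r s 1 ++ U ∷ (DUpow v ++ Y)                             ≡⟨ B-++-U (inj₁ refl) _ ⟩
    U ∷ (DUpow (suc v) ++ Y)                                  ∎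

  partsOfRun-++-U : ∀ x → RCond r s x → ∀ Y → concatMap (B r s) (partsOfRun x) ++ U ∷ Y ≡ U ∷ (run x ++ Y)
  partsOfRun-++-U (zero  , v) _           Y = ones-++-U v Y
  partsOfRun-++-U (suc p , v) (p≤r , c≤v) Y = begin
    (B r s a ++ concatMap (B r s) ones) ++ U ∷ Y        ≡⟨ ++-assoc (B r s a) _ _ ⟩
    B r s a ++ concatMap (B r s) ones ++ U ∷ Y          ≡⟨ cong (B r s a ++_) (ones-++-U (v ∸ c) Y) ⟩
    B r s a ++ U ∷ (DUpow (v ∸ c) ++ Y)                 ≡⟨ B-++-U (inj₂ (suc p , s≤s z≤n , p≤r , refl)) _ ⟩
    U ∷ (run (suc p , c) ++ DUpow (v ∸ c) ++ Y)         ≡⟨ cong (U ∷_) (++-assoc (UDpow (suc p)) _ _) ⟩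
    U ∷ (UDpow (suc p) ++ DUpow c ++ DUpow (v ∸ c) ++ Y) ≡⟨ cong (λ w → U ∷ (UDpow (suc p) ++ w))
                                                             (DUpow-++-DUpow-∸ c≤v Y) ⟩
    U ∷ (UDpow (suc p) ++ DUpow v ++ Y)                 ≡⟨ cong (U ∷_) (++-assoc (UDpow (suc p)) _ _) ⟨
    U ∷ (run (suc p , v) ++ Y)                          ∎
    where
    c = cps r s (suc p)
    a = suc p + c
    ones = replicate (v ∸ c) 1

  partsOf-++-U : ∀ {fs} → All (RCond r s) fs → ∀ Y → concatMap (B r s) (partsOf fs) ++ U ∷ Y ≡ U ∷ (runs fs ++ Y)
  partsOf-++-U []                   Y = refl
  partsOf-++-U {x ∷ fs} (cx ∷ cfs) Y = begin
    concatMap (B r s) (partsOfRun x ++ partsOf fs) ++ U ∷ Y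
      ≡⟨ cong (_++ U ∷ Y) (concatMap-++ (B r s) (partsOfRun x) (partsOf fs)) ⟩
    (concatMap (B r s) (partsOfRun x) ++ concatMap (B r s) (partsOf fs)) ++ U ∷ Y
      ≡⟨ ++-assoc (concatMap (B r s) (partsOfRun x)) _ _ ⟩
    concatMap (B r s) (partsOfRun x) ++ concatMap (B r s) (partsOf fs) ++ U ∷ Y
      ≡⟨ cong (concatMap (B r s) (partsOfRun x) ++_) (partsOf-++-U cfs Y) ⟩
    concatMap (B r s) (partsOfRun x) ++ U ∷ (runs fs ++ Y)
      ≡⟨ partsOfRun-++-U x cx _ ⟩
    U ∷ (run x ++ runs fs ++ Y)
      ≡⟨ cong (U ∷_) (++-assoc (run x) _ _) ⟨
    U ∷ (runs (x ∷ fs) ++ Y)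
      ∎

  Φ-surjective : ∀ n {P} → InR r s (suc n) P →
                 Σ (List ℕ) λ cs → IsComposition n cs × All (InA r s) cs × Φ r s cs ≡ P
  Φ-surjective n {P} (_ , |P|≡ , fs , _ , buildF≡P , fs-R) =
    cs , (All.map (InA⇒1≤ r s) cs∈A , Σcs≡n) , cs∈A , Φcs≡P
    where
    cs : List ℕ
    cs = partsOf fs
    cs∈A : All (InA r s) cs
    cs∈A = partsOf-InA fs-R
    Φcs≡P : Φ r s cs ≡ P
    Φcs≡P = trans (partsOf-++-U fs-R (D ∷ [])) (trans (sym (buildF-runs fs)) buildF≡P)
    Σcs≡n : sum cs ≡ n
    Σcs≡n = suc-injective (*-cancelˡ-≡ _ _ 2 (trans (sym (length-Φ cs∈A)) (trans (cong length Φcs≡P) |P|≡)))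

mainTheorem4 : (r s : ℕ) → 1 ≤ r → 1 ≤ s → Coprime r s → (n : ℕ) →
      ((c : List ℕ) → IsComposition n c → All (InA r s) c → InR r s (suc n) (Φ r s c))
    × ((c c' : List ℕ) → IsComposition n c → All (InA r s) c →
        IsComposition n c' → All (InA r s) c' → Φ r s c ≡ Φ r s c' → c ≡ c')
    × ((P : Path) → InR r s (suc n) P →
        Σ (List ℕ) (λ c → IsComposition n c × All (InA r s) c × Φ r s c ≡ P))
mainTheorem4 (suc k) s _ 1≤s _ n =
  (λ _ → Φ-InR n) ,
  (λ _ _ _ c∈A _ c'∈A → Φ-injective c∈A c'∈A) ,
  (λ _ → Φ-surjective n)
  where
  open Admissible k s 1≤s
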